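{- Let $n\ge 7$ be odd and $\{n-1,n\}\subseteq I\subseteq\{2,3,\ldots,n-1,n\}$. Then: (a) if the largest number in $I\setminus\{n-1,n\}$ is odd and $I\ne\{2,3,n-1,n\}$, then $\lambda^I_{(1^n)}>\lambda^I_{(n-1,1)}$; (b) if the largest number in $I\setminus\{n-1,n\}$ is even, then $\lambda^I_{(n-1,1)}>\lambda^I_{(1^n)}$; (c) if $I=\{2,3,n-1,n\}$ or $I=\{n-1,n\}$, then $\lambda^I_{(n-1,1)}=\lambda^I_{(1^n)}$.
   Context: For $\emptyset\ne I\subseteq\{2,\ldots,n\}$, $\lambda^I_{(1^n)}=\sum_{k\in I}\binom nk(k-1)!(-1)^{k-1}$ and $\lambda^I_{(n-1,1)}=\sum_{k\in I}\binom nk(k-1)!\frac{n-k-1}{n-1}$; these are the eigenvalues of the Cayley graph on $S_n$ generated by all cycles with length in $I$ corresponding to the sign and standard representations. -}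

module Defs where

open import Data.Nat using (ℕ; zero; suc; _∸_; _≤_; _<_)
open import Data.Nat.Combinatorics using (_C_)
open import Data.Nat.Properties using ()
open import Data.Bool using (Bool; true; false; if_then_else_)
open import Data.Integer using (ℤ; +_; -_)
open import Data.Rational using (ℚ; _+_; _*_; _÷_; 0ℚ)
open import Data.Nat.Base using (_!)
open import Data.Nat.DivMod using (_%_)
open import Data.Product using (_×_)
open import Relation.Binary.PropositionalEquality using (_≡_)

-- A set I ⊆ {2,…,n} of cycle lengths is represented by its characteristic
-- function ℕ → Bool (required to be false outside {2,…,n} in the statement).
CycleSet : Set
CycleSet = ℕ → Bool

sumFrom2 : ℕ → (ℕ → ℚ) → ℚ
sumFrom2 zero f = 0ℚ
sumFrom2 (suc zero) f = 0ℚ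
sumFrom2 (suc (suc m)) f = sumFrom2 (suc m) f + f (suc (suc m))

ℕtoℚ : ℕ → ℚ
ℕtoℚ m = Data.Rational._/_ (+ m) 1

signPow : ℕ → ℚ
signPow zero = Data.Rational.- Data.Rational.1ℚ
signPow (suc zero) = Data.Rational.1ℚ
signPow (suc (suc k)) = signPow k

-- λ^I_{(1^n)} = Σ_{k∈I} C(n,k) (k-1)! (-1)^(k-1)
λSign : ℕ → CycleSet → ℚ
λSign n I = sumFrom2 n (λ k → if I k then ℕtoℚ ((n C k) Data.Nat.* ((k ∸ 1) !)) * signPow k else 0ℚ)

-- z / (n-1); only used for n ≥ 7 (the n ≤ 1 clauses, where n-1 = 0, are a dummy)
overPred : ℕ → ℤ → ℚ
overPred zero z = 0ℚ
overPred (suc zero) z = 0ℚ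
overPred (suc (suc m)) z = z Data.Rational./ (suc m)

-- λ^I_{(n-1,1)} = Σ_{k∈I} C(n,k) (k-1)! (n-k-1)/(n-1)
-- (note n-k-1 can be -1 for k = n, so it is computed in ℤ)
λStd : ℕ → CycleSet → ℚ
λStd n I = sumFrom2 n (λ k → if I k
  then ℕtoℚ ((n C k) Data.Nat.* ((k ∸ 1) !)) * overPred n (Data.Integer._-_ (+ n) (+ (suc k)))
  else 0ℚ)

IsMaxRest : ℕ → CycleSet → ℕ → Set
IsMaxRest n I m = (2 ≤ m) × (m ≤ n ∸ 2) × (I m ≡ true) × (∀ k → m < k → k ≤ n ∸ 2 → I k ≡ false)

Is23 : ℕ → CycleSet → Set
Is23 n I = (I 2 ≡ true) × (I 3 ≡ true) × (∀ k → 4 ≤ k → k ≤ n ∸ 2 → I k ≡ false)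

IsTop : ℕ → CycleSet → Set
IsTop n I = ∀ k → 2 ≤ k → k ≤ n ∸ 2 → I k ≡ false

Odd : ℕ → Set
Odd m = m % 2 ≡ 1

Even : ℕ → Set
Even m = m % 2 ≡ 0

-- Multiplying by n − 1 makes both eigenvalues integers, and (n − 1)(λ_{(1^n)} − λ_{(n−1,1)}) is
-- the sum over k ∈ I of the number of k-cycles times (n − 1)(−1)^{k−1} − (n − k − 1): this is
-- (n)_k = n!/(n − k)! for odd k and −(n)_k (2n − 2 − k)/k for even k. The summands for k = n − 1
-- and k = n cancel, and so do those for k = 2 and k = 3. For 3 ≤ j ≤ n − 3 every partial sum
-- over {2, …, j} has absolute value below (n)_{j+1}, since (n)_k plus the k-th summand in
-- absolute value is at most (n)_{k+1} = (n − k)(n)_k. So the summand at the largest element m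
-- of I ∖ {n − 1, n}, of absolute value at least (n)_m, decides the sign
-- (for m = 3 this needs 2 ∉ I).

module Submission where

open import Data.Bool using (true; false; if_then_else_)
open import Data.Bool.Properties using (¬-not)
open import Data.Empty using (⊥-elim)
open import Data.Nat as ℕ using (ℕ; zero; suc; _+_; _*_; _∸_; _≤_; _<_; _≤′_; ≤′-refl; ≤′-step; z≤n; s≤s; _!)
open import Data.Nat.Properties
open import Data.Nat.Combinatorics using (_C_; _P_; nCk≡nPk/k!; nPk≡n!/[n∸k]!)
open import Data.Nat.Combinatorics.Base using (_P′_)
open import Data.Nat.Combinatorics.Specification using (nP′k≡n!/[n∸k]!; k!∣nP′k)
open import Data.Nat.DivMod using (_/_; m/n*n≡m)
import Data.Nat.Tactic.RingSolver as ℕ-Solver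
open import Data.Integer as ℤ using (ℤ; +_; -[1+_]; 0ℤ; ∣_∣)
import Data.Integer.Properties as ℤP
import Data.Integer.Tactic.RingSolver as ℤ-Solver
open import Data.Product using (_×_; _,_)
open import Data.Rational as ℚ using (ℚ; 0ℚ; toℚᵘ)
import Data.Rational.Properties as ℚP
open import Data.Rational.Unnormalised as ℚᵘ using (mkℚᵘ; *≡*; *<*; _≃_)
import Data.Rational.Unnormalised.Properties as ℚᵘP
open import Data.Sum using (_⊎_; inj₁; inj₂)
open import Relation.Binary.PropositionalEquality
open import Relation.Nullary using (¬_)

open import Defs

cycles : ℕ → ℕ → ℕ
cycles n k = (n C k) * (k ∸ 1) !

nCk*k!≡nP′k : ∀ {n k} → k ≤ n → (n C k) * k ! ≡ n P′ k
nCk*k!≡nP′k {n} {k} k≤n = begin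
  (n C k) * k !              ≡⟨ cong (_* k !) (nCk≡nPk/k! k≤n) ⟩
  ((n P k) / k !) * k !      ≡⟨ cong (λ x → (x / k !) * k !) nPk≡nP′k ⟩
  ((n P′ k) / k !) * k !     ≡⟨ m/n*n≡m (k!∣nP′k k≤n) ⟩
  n P′ k                     ∎
  where
  open ≡-Reasoning
  instance _ = k !≢0
  nPk≡nP′k : n P k ≡ n P′ k
  nPk≡nP′k = trans (nPk≡n!/[n∸k]! k≤n) (sym (nP′k≡n!/[n∸k]! k≤n))

k*cycles≡nP′k : ∀ {n k} → suc k ≤ n → suc k * cycles n (suc k) ≡ n P′ suc k
k*cycles≡nP′k {n} {k} k<n = trans (x*[y*z]≡y*[x*z] (suc k) (n C suc k) (k !)) (nCk*k!≡nP′k k<n)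
  where
  x*[y*z]≡y*[x*z] : ∀ x y z → x * (y * z) ≡ y * (x * z)
  x*[y*z]≡y*[x*z] = ℕ-Solver.solve-∀

0<nP′k : ∀ {n k} → k ≤ n → 0 < n P′ k
0<nP′k {k = zero}  _   = s≤s z≤n
0<nP′k {k = suc k} k<n = *-mono-< (m<n⇒0<n∸m k<n) (0<nP′k (<⇒≤ k<n))

sgn : ℕ → ℤ
sgn zero          = ℤ.-1ℤ
sgn (suc zero)    = ℤ.1ℤ
sgn (suc (suc k)) = sgn k

odd⇒sgn≡1 : ∀ {k} → Odd k → sgn k ≡ ℤ.1ℤ
odd⇒sgn≡1 {suc zero}    _ = refl
odd⇒sgn≡1 {suc (suc k)} o = odd⇒sgn≡1 {k} o

even⇒sgn≡-1 : ∀ {k} → Even k → sgn k ≡ ℤ.-1ℤ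
even⇒sgn≡-1 {zero}        _ = refl
even⇒sgn≡-1 {suc (suc k)} e = even⇒sgn≡-1 {k} e

even⊎odd : ∀ k → Even k ⊎ Odd k
even⊎odd zero          = inj₁ refl
even⊎odd (suc zero)    = inj₂ refl
even⊎odd (suc (suc k)) = even⊎odd k

odd-suc⇒even : ∀ {k} → Odd (suc k) → Even k
odd-suc⇒even {zero}        _ = refl
odd-suc⇒even {suc (suc k)} o = odd-suc⇒even {k} o

Σ₂ : ℕ → (ℕ → ℤ) → ℤ
Σ₂ zero          f = 0ℤ
Σ₂ (suc zero)    f = 0ℤ
Σ₂ (suc (suc j)) f = Σ₂ (suc j) f ℤ.+ f (suc (suc j))

Σ₂-+ : ∀ j {f g h : ℕ → ℤ} → (∀ k → f k ≡ g k ℤ.+ h k) → Σ₂ j f ≡ Σ₂ j g ℤ.+ Σ₂ j h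
Σ₂-+ zero          _   = refl
Σ₂-+ (suc zero)    _   = refl
Σ₂-+ (suc (suc j)) {f} {g} {h} f≡g+h = begin
  Σ₂ (suc j) f ℤ.+ f (2 + j)                          ≡⟨ cong₂ ℤ._+_ (Σ₂-+ (suc j) f≡g+h) (f≡g+h (2 + j)) ⟩
  (Σ₂ (suc j) g ℤ.+ Σ₂ (suc j) h) ℤ.+ (g (2 + j) ℤ.+ h (2 + j)) ≡⟨ interchange (Σ₂ (suc j) g) _ _ _ ⟩
  (Σ₂ (suc j) g ℤ.+ g (2 + j)) ℤ.+ (Σ₂ (suc j) h ℤ.+ h (2 + j)) ∎
  where
  open ≡-Reasoning
  open import Algebra.Properties.CommutativeSemigroup ℤP.+-commutativeSemigroup using (interchange)

Σ₂-suc : ∀ {j} f → 1 ≤ j → Σ₂ (suc j) f ≡ Σ₂ j f ℤ.+ f (suc j)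
Σ₂-suc {suc j} _ _ = refl

Σ₂-vanishing-tail : ∀ {m j} f → m ≤′ j → (∀ k → m < k → k ≤ j → f k ≡ 0ℤ) → Σ₂ j f ≡ Σ₂ m f
Σ₂-vanishing-tail f ≤′-refl _ = refl
Σ₂-vanishing-tail {m} {suc j} f (≤′-step m≤′j) f≡0 = begin
  Σ₂ (suc j) f        ≡⟨ drop-last j (f≡0 (suc j) (s≤s (≤′⇒≤ m≤′j)) ≤-refl) ⟩
  Σ₂ j f              ≡⟨ Σ₂-vanishing-tail f m≤′j (λ k m<k k≤j → f≡0 k m<k (m≤n⇒m≤1+n k≤j)) ⟩
  Σ₂ m f              ∎
  where
  open ≡-Reasoning
  drop-last : ∀ j → f (suc j) ≡ 0ℤ → Σ₂ (suc j) f ≡ Σ₂ j f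
  drop-last zero    _  = refl
  drop-last (suc j) eq = trans (cong (λ x → Σ₂ (suc j) f ℤ.+ x) eq) (ℤP.+-identityʳ _)

toℚᵘ-ℕtoℚ : ∀ m → toℚᵘ (ℕtoℚ m) ≃ mkℚᵘ (+ m) 0
toℚᵘ-ℕtoℚ m = ℚP.toℚᵘ-fromℚᵘ (mkℚᵘ (+ m) 0)

toℚᵘ-signPow : ∀ k → toℚᵘ (signPow k) ≃ mkℚᵘ (sgn k) 0
toℚᵘ-signPow zero          = *≡* refl
toℚᵘ-signPow (suc zero)    = *≡* refl
toℚᵘ-signPow (suc (suc k)) = toℚᵘ-signPow k

toℚᵘ-overPred : ∀ d z → toℚᵘ (overPred (2 + d) z) ≃ mkℚᵘ z d
toℚᵘ-overPred d z = ℚP.toℚᵘ-fromℚᵘ (mkℚᵘ z d)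

mkℚᵘ-+ : ∀ i j d → mkℚᵘ i d ℚᵘ.+ mkℚᵘ j d ≃ mkℚᵘ (i ℤ.+ j) d
mkℚᵘ-+ i j d = *≡* (trans (distrib i j (+ suc d)) (cong ((i ℤ.+ j) ℤ.*_) (sym (ℤP.pos-* (suc d) (suc d)))))
  where
  distrib : ∀ a b c → (a ℤ.* c ℤ.+ b ℤ.* c) ℤ.* c ≡ (a ℤ.+ b) ℤ.* (c ℤ.* c)
  distrib = ℤ-Solver.solve-∀

toℚᵘ-sumFrom2 : ∀ d j {f : ℕ → ℚ} {g : ℕ → ℤ} →
  (∀ k → toℚᵘ (f k) ≃ mkℚᵘ (g k) d) → toℚᵘ (sumFrom2 j f) ≃ mkℚᵘ (Σ₂ j g) d
toℚᵘ-sumFrom2 d zero          _ = *≡* refl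
toℚᵘ-sumFrom2 d (suc zero)    _ = *≡* refl
toℚᵘ-sumFrom2 d (suc (suc j)) {f} {g} f≃g = begin
  toℚᵘ (sumFrom2 (suc j) f ℚ.+ f (2 + j))           ≈⟨ ℚP.toℚᵘ-homo-+ (sumFrom2 (suc j) f) (f (2 + j)) ⟩
  toℚᵘ (sumFrom2 (suc j) f) ℚᵘ.+ toℚᵘ (f (2 + j))  ≈⟨ ℚᵘP.+-cong (toℚᵘ-sumFrom2 d (suc j) f≃g) (f≃g (2 + j)) ⟩
  mkℚᵘ (Σ₂ (suc j) g) d ℚᵘ.+ mkℚᵘ (g (2 + j)) d      ≈⟨ mkℚᵘ-+ (Σ₂ (suc j) g) (g (2 + j)) d ⟩
  mkℚᵘ (Σ₂ (2 + j) g) d                              ∎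
  where open ℚᵘP.≃-Reasoning

toℚᵘ-if : ∀ b {p i d} → toℚᵘ p ≃ mkℚᵘ i d → toℚᵘ (if b then p else 0ℚ) ≃ mkℚᵘ (if b then i else 0ℤ) d
toℚᵘ-if true  p≃i = p≃i
toℚᵘ-if false _   = *≡* refl

<-fromNumerators : ∀ {p q i j d} → toℚᵘ p ≃ mkℚᵘ i d → toℚᵘ q ≃ mkℚᵘ j d → i ℤ.< j → p ℚ.< q
<-fromNumerators {d = d} p≃i q≃j i<j = ℚP.toℚᵘ-cancel-<
  (ℚᵘP.<-respʳ-≃ (ℚᵘP.≃-sym q≃j) (ℚᵘP.<-respˡ-≃ (ℚᵘP.≃-sym p≃i) (*<* (ℤP.*-monoʳ-<-pos (+ suc d) i<j))))

≡-fromNumerators : ∀ {p q i d} → toℚᵘ p ≃ mkℚᵘ i d → toℚᵘ q ≃ mkℚᵘ i d → p ≡ q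
≡-fromNumerators p≃i q≃i = ℚP.toℚᵘ-injective (ℚᵘP.≃-trans p≃i (ℚᵘP.≃-sym q≃i))

-- That is, (k − 2)(j − 2) ≥ 2.
[k+j]+[k+j]≤2+j*k : ∀ {k j} → 4 ≤ k → 3 ≤ j → (k + j) + (k + j) ≤ 2 + j * k
[k+j]+[k+j]≤2+j*k 4≤k 3≤j with m≤n⇒∃[o]m+o≡n 4≤k | m≤n⇒∃[o]m+o≡n 3≤j
... | y , refl | x , refl = subst ((4 + y + (3 + x)) + (4 + y + (3 + x)) ≤_) (expand x y) (m≤m+n _ _)
  where
  expand : ∀ x y → (4 + y + (3 + x)) + (4 + y + (3 + x)) + (2 * x + y + x * y) ≡ 2 + (3 + x) * (4 + y)
  expand = ℕ-Solver.solve-∀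

0<i+n : ∀ i {n} → ∣ i ∣ < n → 0ℤ ℤ.< i ℤ.+ + n
0<i+n (+ a)    {suc n} _   = ℤ.+<+ (≤-trans (s≤s z≤n) (m≤n+m (suc n) a))
0<i+n -[1+ a ] {n}     a<n = subst (0ℤ ℤ.<_) (sym (ℤP.⊖-≥ (<⇒≤ a<n))) (ℤ.+<+ (m<n⇒0<n∸m a<n))

i-n<0 : ∀ i {n} → ∣ i ∣ < n → i ℤ.- + n ℤ.< 0ℤ
i-n<0 i {n} ∣i∣<n = subst (ℤ._< 0ℤ) (negate i (+ n))
  (ℤP.neg-mono-< (0<i+n (ℤ.- i) (subst (_< n) (sym (ℤP.∣-i∣≡∣i∣ i)) ∣i∣<n)))
  where
  negate : ∀ i m → ℤ.- (ℤ.- i ℤ.+ m) ≡ i ℤ.- m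
  negate = ℤ-Solver.solve-∀

restrict : CycleSet → (ℕ → ℤ) → ℕ → ℤ
restrict I f k = if I k then f k else 0ℤ

restrict-∈ : ∀ I f {k} → I k ≡ true → restrict I f k ≡ f k
restrict-∈ _ _ I[k] rewrite I[k] = refl

restrict-∉ : ∀ I f {k} → I k ≡ false → restrict I f k ≡ 0ℤ
restrict-∉ _ _ I[k] rewrite I[k] = refl

∣restrict∣≤ : ∀ I f k → ∣ restrict I f k ∣ ≤ ∣ f k ∣
∣restrict∣≤ I f k with I k
... | true  = ≤-refl
... | false = z≤n

module Gap (n-2 : ℕ) where

  n n-1 : ℕ
  n   = 2 + n-2
  n-1 = 1 + n-2

  signTerm stdTerm δ term : ℕ → ℤ
  signTerm k = + cycles n k ℤ.* sgn k ℤ.* + n-1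
  stdTerm  k = + cycles n k ℤ.* (+ n ℤ.- + suc k)
  δ        k = sgn k ℤ.* + n-1 ℤ.- (+ n ℤ.- + suc k)
  term     k = + cycles n k ℤ.* δ k

  evenWeight : ℕ → ℕ
  evenWeight k = cycles n k * (n-1 + n-1 ∸ k)

  n≤n-1+n-1 : n ≤ n-1 + n-1
  n≤n-1+n-1 = s≤s (m≤n+m (suc n-2) n-2)

  signTerm≡stdTerm+term : ∀ k → signTerm k ≡ stdTerm k ℤ.+ term k
  signTerm≡stdTerm+term k = distrib (+ cycles n k) (sgn k) (+ n-1) (+ n ℤ.- + suc k)
    where
    distrib : ∀ a s m z → a ℤ.* s ℤ.* m ≡ a ℤ.* z ℤ.+ a ℤ.* (s ℤ.* m ℤ.- z)
    distrib = ℤ-Solver.solve-∀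

  toℚᵘ-signSummand : ∀ a k → toℚᵘ (ℕtoℚ a ℚ.* signPow k) ≃ mkℚᵘ (+ a ℤ.* sgn k ℤ.* + n-1) n-2
  toℚᵘ-signSummand a k = begin
    toℚᵘ (ℕtoℚ a ℚ.* signPow k)              ≈⟨ ℚP.toℚᵘ-homo-* (ℕtoℚ a) (signPow k) ⟩
    toℚᵘ (ℕtoℚ a) ℚᵘ.* toℚᵘ (signPow k)     ≈⟨ ℚᵘP.*-cong (toℚᵘ-ℕtoℚ a) (toℚᵘ-signPow k) ⟩
    mkℚᵘ (+ a ℤ.* sgn k) 0                   ≈⟨ *≡* (scale (+ a ℤ.* sgn k) (+ n-1)) ⟩
    mkℚᵘ (+ a ℤ.* sgn k ℤ.* + n-1) n-2       ∎
    where
    open ℚᵘP.≃-Reasoning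
    scale : ∀ x m → x ℤ.* m ≡ x ℤ.* m ℤ.* ℤ.1ℤ
    scale = ℤ-Solver.solve-∀

  toℚᵘ-stdSummand : ∀ a z → toℚᵘ (ℕtoℚ a ℚ.* overPred n z) ≃ mkℚᵘ (+ a ℤ.* z) n-2
  toℚᵘ-stdSummand a z = begin
    toℚᵘ (ℕtoℚ a ℚ.* overPred n z)            ≈⟨ ℚP.toℚᵘ-homo-* (ℕtoℚ a) (overPred n z) ⟩
    toℚᵘ (ℕtoℚ a) ℚᵘ.* toℚᵘ (overPred n z)   ≈⟨ ℚᵘP.*-cong (toℚᵘ-ℕtoℚ a) (toℚᵘ-overPred n-2 z) ⟩
    mkℚᵘ (+ a ℤ.* z) (ℕ.pred (1 * n-1))        ≈⟨ *≡* (cong (λ m → + a ℤ.* z ℤ.* + m) (sym (*-identityˡ n-1))) ⟩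
    mkℚᵘ (+ a ℤ.* z) n-2                       ∎
    where open ℚᵘP.≃-Reasoning

  δ-odd : ∀ {k} → Odd k → δ k ≡ + k
  δ-odd {k} odd-k = begin
    sgn k ℤ.* + n-1 ℤ.- (+ n ℤ.- + suc k)      ≡⟨ cong (λ s → s ℤ.* + n-1 ℤ.- (+ n ℤ.- + suc k)) (odd⇒sgn≡1 {k} odd-k) ⟩
    ℤ.1ℤ ℤ.* + n-1 ℤ.- (+ n ℤ.- + suc k)       ≡⟨ cancel (+ n-2) (+ k) ⟩
    + k                                        ∎
    where
    open ≡-Reasoning
    cancel : ∀ m k → ℤ.1ℤ ℤ.* (ℤ.1ℤ ℤ.+ m) ℤ.- ((ℤ.1ℤ ℤ.+ (ℤ.1ℤ ℤ.+ m)) ℤ.- (ℤ.1ℤ ℤ.+ k)) ≡ k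
    cancel = ℤ-Solver.solve-∀

  δ-even : ∀ {k} → Even k → k ≤ n-1 + n-1 → δ k ≡ ℤ.- + (n-1 + n-1 ∸ k)
  δ-even {k} even-k k≤w = begin
    sgn k ℤ.* + n-1 ℤ.- (+ n ℤ.- + suc k)      ≡⟨ cong (λ s → s ℤ.* + n-1 ℤ.- (+ n ℤ.- + suc k)) (even⇒sgn≡-1 {k} even-k) ⟩
    ℤ.-1ℤ ℤ.* + n-1 ℤ.- (+ n ℤ.- + suc k)      ≡⟨ regroup (+ n-2) (+ k) ⟩
    ℤ.- (+ n-1 ℤ.+ + n-1 ℤ.- + k)              ≡⟨ cong (λ x → ℤ.- (x ℤ.- + k)) (sym (ℤP.pos-+ n-1 n-1)) ⟩
    ℤ.- (+ (n-1 + n-1) ℤ.- + k)                ≡⟨ cong ℤ.-_ (trans (ℤP.m-n≡m⊖n (n-1 + n-1) k) (ℤP.⊖-≥ k≤w)) ⟩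
    ℤ.- + (n-1 + n-1 ∸ k)                      ∎
    where
    open ≡-Reasoning
    regroup : ∀ m k → ℤ.-1ℤ ℤ.* (ℤ.1ℤ ℤ.+ m) ℤ.- ((ℤ.1ℤ ℤ.+ (ℤ.1ℤ ℤ.+ m)) ℤ.- (ℤ.1ℤ ℤ.+ k))
                      ≡ ℤ.- ((ℤ.1ℤ ℤ.+ m) ℤ.+ (ℤ.1ℤ ℤ.+ m) ℤ.- k)
    regroup = ℤ-Solver.solve-∀

  term-odd : ∀ {k} → Odd k → k ≤ n → term k ≡ + (n P′ k)
  term-odd {suc k} odd-k k<n = begin
    + cycles n (suc k) ℤ.* δ (suc k)           ≡⟨ cong (+ cycles n (suc k) ℤ.*_) (δ-odd odd-k) ⟩
    + cycles n (suc k) ℤ.* + suc k             ≡⟨ ℤP.pos-* (cycles n (suc k)) (suc k) ⟨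
    + (cycles n (suc k) * suc k)               ≡⟨ cong +_ (trans (*-comm (cycles n (suc k)) (suc k)) (k*cycles≡nP′k {n} k<n)) ⟩
    + (n P′ suc k)                             ∎
    where open ≡-Reasoning

  term-even : ∀ {k} → Even k → k ≤ n-1 + n-1 → term k ≡ ℤ.- + evenWeight k
  term-even {k} even-k k≤w = begin
    + cycles n k ℤ.* δ k                         ≡⟨ cong (+ cycles n k ℤ.*_) (δ-even even-k k≤w) ⟩
    + cycles n k ℤ.* ℤ.- + (n-1 + n-1 ∸ k)       ≡⟨ ℤP.neg-distribʳ-* (+ cycles n k) _ ⟨
    ℤ.- (+ cycles n k ℤ.* + (n-1 + n-1 ∸ k))     ≡⟨ cong ℤ.-_ (ℤP.pos-* (cycles n k) _) ⟨
    ℤ.- + evenWeight k                           ∎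
    where open ≡-Reasoning

  nP′k≤evenWeight : ∀ {k} → 1 ≤ k → k ≤ n-1 → n P′ k ≤ evenWeight k
  nP′k≤evenWeight {suc k} _ k<n = begin
    n P′ suc k                           ≡⟨ k*cycles≡nP′k {n} (m≤n⇒m≤1+n k<n) ⟨
    suc k * cycles n (suc k)             ≡⟨ *-comm (suc k) _ ⟩
    cycles n (suc k) * suc k             ≤⟨ *-monoʳ-≤ (cycles n (suc k)) (m+n≤o⇒m≤o∸n (suc k) (+-mono-≤ k<n k<n)) ⟩
    cycles n (suc k) * (n-1 + n-1 ∸ suc k) ∎
    where open ≤-Reasoning

  term-2 : term 2 ≡ ℤ.- + (n P′ 3)
  term-2 = trans (term-even {2} refl (≤-trans (s≤s (s≤s z≤n)) n≤n-1+n-1)) (cong (λ x → ℤ.- + x) weight≡nP′3)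
    where
    open ≡-Reasoning
    twice : ∀ a m → a * (m + m) ≡ m * (2 * a)
    twice = ℕ-Solver.solve-∀
    weight≡nP′3 : evenWeight 2 ≡ n P′ 3
    weight≡nP′3 = begin
      cycles n 2 * (n-1 + n-1 ∸ 2)   ≡⟨ cong (λ x → cycles n 2 * (x ∸ 1)) (+-suc n-2 n-2) ⟩
      cycles n 2 * (n-2 + n-2)       ≡⟨ twice (cycles n 2) n-2 ⟩
      n-2 * (2 * cycles n 2)         ≡⟨ cong (n-2 *_) (k*cycles≡nP′k {n} (s≤s (s≤s z≤n))) ⟩
      n-2 * (n P′ 2)                 ∎

  nP′k+∣term∣≤nP′[1+k] : ∀ {k} → 4 ≤ k → 3 + k ≤ n → n P′ k + ∣ term k ∣ ≤ n P′ suc k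
  nP′k+∣term∣≤nP′[1+k] {k@(suc k-1)} 4≤k 3+k≤n with even⊎odd k | m+n≤o⇒n≤o 3 3+k≤n | m+n≤o⇒m≤o∸n 3 3+k≤n
  ... | inj₂ odd-k | k≤n | 3≤n∸k = begin
    n P′ k + ∣ term k ∣          ≡⟨ cong (λ t → n P′ k + ∣ t ∣) (term-odd odd-k k≤n) ⟩
    n P′ k + n P′ k              ≡⟨ cong (λ x → n P′ k + x) (+-identityʳ (n P′ k)) ⟨
    2 * (n P′ k)                 ≤⟨ *-monoˡ-≤ (n P′ k) (<⇒≤ 3≤n∸k) ⟩
    (n ∸ k) * (n P′ k)           ∎
    where open ≤-Reasoning
  ... | inj₁ even-k | k≤n | 3≤n∸k = begin
    n P′ k + ∣ term k ∣                  ≡⟨ cong (λ t → n P′ k + ∣ t ∣) (term-even even-k k≤w) ⟩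
    n P′ k + ∣ ℤ.- + evenWeight k ∣      ≡⟨ cong (λ x → n P′ k + x) (ℤP.∣-i∣≡∣i∣ (+ evenWeight k)) ⟩
    n P′ k + A * (w ∸ k)                 ≡⟨ cong (_+ A * (w ∸ k)) (trans (sym (k*cycles≡nP′k {n} k≤n)) (*-comm k A)) ⟩
    A * k + A * (w ∸ k)                  ≡⟨ *-distribˡ-+ A k (w ∸ k) ⟨
    A * (k + (w ∸ k))                    ≡⟨ cong (A *_) (m+[n∸m]≡n k≤w) ⟩
    A * w                                ≤⟨ *-monoʳ-≤ A w≤[n∸k]*k ⟩
    A * ((n ∸ k) * k)                    ≡⟨ x*[y*z]≡y*[z*x] A (n ∸ k) k ⟩
    (n ∸ k) * (k * A)                    ≡⟨ cong ((n ∸ k) *_) (k*cycles≡nP′k {n} k≤n) ⟩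
    (n ∸ k) * (n P′ k)                   ∎
    where
    open ≤-Reasoning
    A w : ℕ
    A = cycles n k
    w = n-1 + n-1
    k≤w : k ≤ w
    k≤w = ≤-trans k≤n n≤n-1+n-1
    x*[y*z]≡y*[z*x] : ∀ x y z → x * (y * z) ≡ y * (z * x)
    x*[y*z]≡y*[z*x] = ℕ-Solver.solve-∀
    w≤[n∸k]*k : w ≤ (n ∸ k) * k
    w≤[n∸k]*k = +-cancelˡ-≤ 2 w ((n ∸ k) * k) (begin
      2 + w                          ≡⟨ cong (λ x → suc (suc x)) (+-suc n-2 (suc n-2)) ⟨
      n + n                          ≡⟨ cong (λ x → x + x) (m+[n∸m]≡n k≤n) ⟨
      (k + (n ∸ k)) + (k + (n ∸ k))  ≤⟨ [k+j]+[k+j]≤2+j*k 4≤k 3≤n∸k ⟩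
      2 + (n ∸ k) * k                ∎)

  module _ (I : CycleSet) where

    Δ : ℕ → ℤ
    Δ j = Σ₂ j (restrict I term)

    signNumerator stdNumerator : ℤ
    signNumerator = Σ₂ n (restrict I signTerm)
    stdNumerator  = Σ₂ n (restrict I stdTerm)

    λSign≃ : toℚᵘ (λSign n I) ≃ mkℚᵘ signNumerator n-2
    λSign≃ = toℚᵘ-sumFrom2 n-2 n (λ k → toℚᵘ-if (I k) (toℚᵘ-signSummand (cycles n k) k))

    λStd≃ : toℚᵘ (λStd n I) ≃ mkℚᵘ stdNumerator n-2
    λStd≃ = toℚᵘ-sumFrom2 n-2 n (λ k → toℚᵘ-if (I k) (toℚᵘ-stdSummand (cycles n k) (+ n ℤ.- + suc k)))

    signNumerator≡stdNumerator+Δ : signNumerator ≡ stdNumerator ℤ.+ Δ n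
    signNumerator≡stdNumerator+Δ = Σ₂-+ n pointwise
      where
      pointwise : ∀ k → restrict I signTerm k ≡ restrict I stdTerm k ℤ.+ restrict I term k
      pointwise k with I k
      ... | true  = signTerm≡stdTerm+term k
      ... | false = refl

    λStd<λSign : 0ℤ ℤ.< Δ n → λStd n I ℚ.< λSign n I
    λStd<λSign 0<Δ = <-fromNumerators λStd≃ λSign≃
      (subst₂ ℤ._<_ (ℤP.+-identityʳ stdNumerator) (sym signNumerator≡stdNumerator+Δ) (ℤP.+-monoʳ-< stdNumerator 0<Δ))

    λSign<λStd : Δ n ℤ.< 0ℤ → λSign n I ℚ.< λStd n I
    λSign<λStd Δ<0 = <-fromNumerators λSign≃ λStd≃
      (subst₂ ℤ._<_ (sym signNumerator≡stdNumerator+Δ) (ℤP.+-identityʳ stdNumerator) (ℤP.+-monoʳ-< stdNumerator Δ<0))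

    λStd≡λSign : Δ n ≡ 0ℤ → λStd n I ≡ λSign n I
    λStd≡λSign Δ≡0 = ≡-fromNumerators λStd≃ (ℚᵘP.≃-trans λSign≃ (*≡* (cong (ℤ._* + n-1) signNumerator≡stdNumerator)))
      where
      signNumerator≡stdNumerator : signNumerator ≡ stdNumerator
      signNumerator≡stdNumerator = begin
        signNumerator                ≡⟨ signNumerator≡stdNumerator+Δ ⟩
        stdNumerator ℤ.+ Δ n         ≡⟨ cong (λ x → stdNumerator ℤ.+ x) Δ≡0 ⟩
        stdNumerator ℤ.+ 0ℤ          ≡⟨ ℤP.+-identityʳ stdNumerator ⟩
        stdNumerator                 ∎
        where open ≡-Reasoning

    ∣Δ-suc∣≤ : ∀ j → ∣ Δ (2 + j) ∣ ≤ ∣ Δ (1 + j) ∣ + ∣ term (2 + j) ∣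
    ∣Δ-suc∣≤ j = ≤-trans (ℤP.∣i+j∣≤∣i∣+∣j∣ (Δ (1 + j)) _) (+-monoʳ-≤ ∣ Δ (1 + j) ∣ (∣restrict∣≤ I term (2 + j)))

    ∣Δ∣<nP′ : ∀ i → 6 + i ≤ n → ∣ Δ (3 + i) ∣ < n P′ (4 + i)
    ∣Δ∣<nP′ zero 6≤n = begin-strict
      ∣ Δ 3 ∣                              ≤⟨ ∣Δ-suc∣≤ 1 ⟩
      ∣ Δ 2 ∣ + ∣ term 3 ∣                  ≤⟨ +-monoˡ-≤ ∣ term 3 ∣ (∣Δ-suc∣≤ 0) ⟩
      ∣ term 2 ∣ + ∣ term 3 ∣               ≡⟨ cong₂ (λ x y → ∣ x ∣ + ∣ y ∣) term-2 (term-odd {3} refl 3≤n) ⟩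
      ∣ ℤ.- + (n P′ 3) ∣ + n P′ 3           ≡⟨ cong (_+ n P′ 3) (ℤP.∣-i∣≡∣i∣ (+ (n P′ 3))) ⟩
      n P′ 3 + n P′ 3                      ≡⟨ cong (λ x → n P′ 3 + x) (+-identityʳ (n P′ 3)) ⟨
      2 * (n P′ 3)                         <⟨ *-monoˡ-< (n P′ 3) {{ℕ.>-nonZero (0<nP′k {n} 3≤n)}} (m+n≤o⇒m≤o∸n 3 6≤n) ⟩
      (n ∸ 3) * (n P′ 3)                   ∎
      where
      open ≤-Reasoning
      3≤n : 3 ≤ n
      3≤n = m+n≤o⇒n≤o 3 6≤n
    ∣Δ∣<nP′ (suc i) 7+i≤n = begin-strict
      ∣ Δ (4 + i) ∣                        ≤⟨ ∣Δ-suc∣≤ (2 + i) ⟩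
      ∣ Δ (3 + i) ∣ + ∣ term (4 + i) ∣      <⟨ +-monoˡ-< ∣ term (4 + i) ∣ (∣Δ∣<nP′ i (<⇒≤ 7+i≤n)) ⟩
      n P′ (4 + i) + ∣ term (4 + i) ∣       ≤⟨ nP′k+∣term∣≤nP′[1+k] (m≤m+n 4 i) 7+i≤n ⟩
      n P′ (5 + i)                         ∎
      where open ≤-Reasoning

    Δ-dominated : ∀ j → 2 + j ≤ n-2 → (2 + j ≡ 3 → I 2 ≡ false) → ∣ Δ (1 + j) ∣ < n P′ (2 + j)
    Δ-dominated zero          _       _          = 0<nP′k {n} (s≤s (s≤s z≤n))
    Δ-dominated (suc zero)    3≤n-2   I[2]≡false =
      subst (λ x → ∣ 0ℤ ℤ.+ x ∣ < n P′ 3) (sym (restrict-∉ I term (I[2]≡false refl)))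
        (0<nP′k {n} (≤-trans 3≤n-2 (m≤n+m n-2 2)))
    Δ-dominated (suc (suc i)) 4+i≤n-2 _          = ∣Δ∣<nP′ i (s≤s (s≤s 4+i≤n-2))

    Δ>0 : ∀ j → Odd (2 + j) → I (2 + j) ≡ true → 2 + j ≤ n → ∣ Δ (1 + j) ∣ < n P′ (2 + j) → 0ℤ ℤ.< Δ (2 + j)
    Δ>0 j odd I[2+j] 2+j≤n ∣Δ∣<nP′ = subst (0ℤ ℤ.<_) (sym Δ≡) (0<i+n (Δ (1 + j)) ∣Δ∣<nP′)
      where
      Δ≡ : Δ (2 + j) ≡ Δ (1 + j) ℤ.+ + (n P′ (2 + j))
      Δ≡ = cong (λ x → Δ (1 + j) ℤ.+ x) (trans (restrict-∈ I term I[2+j]) (term-odd odd 2+j≤n))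

    Δ<0 : ∀ j → Even (2 + j) → I (2 + j) ≡ true → 2 + j ≤ n-1 → ∣ Δ (1 + j) ∣ < n P′ (2 + j) → Δ (2 + j) ℤ.< 0ℤ
    Δ<0 j even I[2+j] 2+j≤n-1 ∣Δ∣<nP′ =
      subst (ℤ._< 0ℤ) (sym Δ≡) (i-n<0 (Δ (1 + j)) (<-≤-trans ∣Δ∣<nP′ (nP′k≤evenWeight (s≤s z≤n) 2+j≤n-1)))
      where
      Δ≡ : Δ (2 + j) ≡ Δ (1 + j) ℤ.- + evenWeight (2 + j)
      Δ≡ = cong (λ x → Δ (1 + j) ℤ.+ x)
        (trans (restrict-∈ I term I[2+j]) (term-even even (≤-trans 2+j≤n-1 (m≤m+n n-1 n-1))))

    Δ3≡0 : 3 ≤ n → I 2 ≡ true → I 3 ≡ true → Δ 3 ≡ 0ℤ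
    Δ3≡0 3≤n I[2] I[3] = begin
      0ℤ ℤ.+ restrict I term 2 ℤ.+ restrict I term 3   ≡⟨ cong₂ (λ x y → 0ℤ ℤ.+ x ℤ.+ y) (restrict-∈ I term I[2]) (restrict-∈ I term I[3]) ⟩
      0ℤ ℤ.+ term 2 ℤ.+ term 3                         ≡⟨ cong₂ (λ x y → 0ℤ ℤ.+ x ℤ.+ y) term-2 (term-odd {3} refl 3≤n) ⟩
      0ℤ ℤ.+ ℤ.- + (n P′ 3) ℤ.+ + (n P′ 3)             ≡⟨ cancel (+ (n P′ 3)) ⟩
      0ℤ                                               ∎
      where
      open ≡-Reasoning
      cancel : ∀ x → 0ℤ ℤ.+ ℤ.- x ℤ.+ x ≡ 0ℤ
      cancel = ℤ-Solver.solve-∀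

    Δn≡Δ[n-2] : Odd n → I n-1 ≡ true → I n ≡ true → 1 ≤ n-2 → Δ n ≡ Δ n-2
    Δn≡Δ[n-2] odd-n I[n-1] I[n] 1≤n-2 = begin
      Δ n-1 ℤ.+ restrict I term n                         ≡⟨ cong₂ ℤ._+_ (Σ₂-suc (restrict I term) 1≤n-2) (restrict-∈ I term I[n]) ⟩
      Δ n-2 ℤ.+ restrict I term n-1 ℤ.+ term n            ≡⟨ cong (λ x → Δ n-2 ℤ.+ x ℤ.+ term n) (restrict-∈ I term I[n-1]) ⟩
      Δ n-2 ℤ.+ term n-1 ℤ.+ term n                       ≡⟨ cong₂ (λ x y → Δ n-2 ℤ.+ x ℤ.+ y)
                                                              (term-even (odd-suc⇒even {n-1} odd-n) (m≤m+n n-1 n-1))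
                                                              (term-odd {n} odd-n ≤-refl) ⟩
      Δ n-2 ℤ.+ ℤ.- + evenWeight n-1 ℤ.+ + (n P′ n)       ≡⟨ cong (λ x → Δ n-2 ℤ.+ ℤ.- + evenWeight n-1 ℤ.+ + x) nP′n≡evenWeight ⟩
      Δ n-2 ℤ.+ ℤ.- + evenWeight n-1 ℤ.+ + evenWeight n-1 ≡⟨ cancel (Δ n-2) (+ evenWeight n-1) ⟩
      Δ n-2                                               ∎
      where
      open ≡-Reasoning
      cancel : ∀ a x → a ℤ.+ ℤ.- x ℤ.+ x ≡ a
      cancel = ℤ-Solver.solve-∀
      nP′n≡evenWeight : n P′ n ≡ evenWeight n-1
      nP′n≡evenWeight = begin
        (n ∸ n-1) * (n P′ n-1)              ≡⟨ cong (_* (n P′ n-1)) (m+n∸n≡m 1 n-1) ⟩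
        1 * (n P′ n-1)                      ≡⟨ *-identityˡ (n P′ n-1) ⟩
        n P′ n-1                            ≡⟨ k*cycles≡nP′k {n} (n≤1+n n-1) ⟨
        n-1 * cycles n n-1                  ≡⟨ *-comm n-1 (cycles n n-1) ⟩
        cycles n n-1 * n-1                  ≡⟨ cong (cycles n n-1 *_) (m+n∸n≡m n-1 n-1) ⟨
        evenWeight n-1                      ∎

    Δn≡Δlast : Odd n → I n-1 ≡ true → I n ≡ true →
      ∀ {m} → 1 ≤ m → m ≤ n-2 → (∀ k → m < k → k ≤ n-2 → I k ≡ false) → Δ n ≡ Δ m
    Δn≡Δlast odd-n I[n-1] I[n] 1≤m m≤n-2 above = trans (Δn≡Δ[n-2] odd-n I[n-1] I[n] (≤-trans 1≤m m≤n-2))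
      (Σ₂-vanishing-tail _ (≤⇒≤′ m≤n-2) (λ k m<k k≤n-2 → restrict-∉ I term (above k m<k k≤n-2)))

lemma6p1 : (n : ℕ) → 7 ≤ n → Odd n → (I : CycleSet) →
    (∀ k → I k ≡ true → 2 ≤ k × k ≤ n) →
    I (n ∸ 1) ≡ true → I n ≡ true →
    (∀ m → IsMaxRest n I m → Odd m → ¬ Is23 n I → λStd n I ℚ.< λSign n I) ×
    (∀ m → IsMaxRest n I m → Even m → λSign n I ℚ.< λStd n I) ×
    ((Is23 n I → λStd n I ≡ λSign n I) × (IsTop n I → λStd n I ≡ λSign n I))
lemma6p1 (suc zero) (s≤s ()) _ _ _ _ _
lemma6p1 (suc (suc n-2)) 7≤n odd-n I _ I[n-1] I[n] = odd-max , even-max , with-2-3 , without-rest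
  where
  open Gap n-2
  3≤n-2 : 3 ≤ n-2
  3≤n-2 = ≤-trans (s≤s (s≤s (s≤s z≤n))) (≤-pred (≤-pred 7≤n))
  Δn≡Δm : ∀ {m} → 1 ≤ m → m ≤ n-2 → (∀ k → m < k → k ≤ n-2 → I k ≡ false) → Δ I n ≡ Δ I m
  Δn≡Δm = Δn≡Δlast I odd-n I[n-1] I[n]
  odd-max : ∀ m → IsMaxRest n I m → Odd m → ¬ Is23 n I → λStd n I ℚ.< λSign n I
  odd-max (suc zero)    (s≤s () , _)
  odd-max (suc (suc j)) (_ , m≤n-2 , I[m] , above) odd-m ¬23 = λStd<λSign I
    (subst (0ℤ ℤ.<_) (sym (Δn≡Δm (s≤s z≤n) m≤n-2 above))
      (Δ>0 I j odd-m I[m] (≤-trans m≤n-2 (m≤n+m n-2 2)) (Δ-dominated I j m≤n-2 I[2]≡false)))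
    where
    I[2]≡false : 2 + j ≡ 3 → I 2 ≡ false
    I[2]≡false refl = ¬-not (λ I[2] → ¬23 (I[2] , I[m] , above))
  even-max : ∀ m → IsMaxRest n I m → Even m → λSign n I ℚ.< λStd n I
  even-max (suc (suc j)) (_ , m≤n-2 , I[m] , above) even-m = λSign<λStd I
    (subst (ℤ._< 0ℤ) (sym (Δn≡Δm (s≤s z≤n) m≤n-2 above))
      (Δ<0 I j even-m I[m] (≤-trans m≤n-2 (n≤1+n n-2)) (Δ-dominated I j m≤n-2 (λ { refl → ⊥-elim (1+n≢0 even-m) }))))
  with-2-3 : Is23 n I → λStd n I ≡ λSign n I
  with-2-3 (I[2] , I[3] , above) = λStd≡λSign I
    (trans (Δn≡Δm (s≤s z≤n) 3≤n-2 above) (Δ3≡0 I (≤-trans 3≤n-2 (m≤n+m n-2 2)) I[2] I[3]))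
  without-rest : IsTop n I → λStd n I ≡ λSign n I
  without-rest above = λStd≡λSign I (Δn≡Δm ≤-refl (≤-trans (s≤s z≤n) 3≤n-2) above)
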